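{- Let $V$ be a finite nonempty set, let $X$ be a nonempty subset of $\mathbb{B}^V$, and let $N(X)=\{x\oplus e_i : x\in X,\ i\in V\}$. If $X\cap N(X)=\emptyset$ and $|X|\geq |N(X)|$, then $X$ is either the set of all even points of $\mathbb{B}^V$ or the set of all odd points of $\mathbb{B}^V$.
   Context: $\mathbb{B}=\{0,1\}$; $\oplus$ is componentwise addition mod 2; $e_i$ is the point of $\mathbb{B}^V$ whose only component equal to 1 is $i$. A point is even (resp. odd) if its number of components equal to 1 is even (resp. odd). -}

module Defs where

open import Data.Nat using (ℕ; zero; suc; _+_)
open import Data.Bool using (Bool; true; false; _xor_; not; _∨_; _∧_; if_then_else_)
open import Data.Fin using (Fin; zero; suc)
open import Data.Vec using (Vec; []; _∷_; zipWith; tabulate)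
open import Data.List using (List; []; _∷_; filter; length)
open import Data.Bool.ListAction using (any)
import Data.List as List
import Data.Fin.Properties as FinP
import Data.Bool.Properties as BoolP
open import Relation.Nullary using (does)

-- Points of 𝔹^V with V = Fin n
Point : ℕ → Set
Point n = Vec Bool n

SubsetB : ℕ → Set
SubsetB n = Point n → Bool

_⊕_ : ∀ {n} → Point n → Point n → Point n
x ⊕ y = zipWith _xor_ x y

e : ∀ {n} → Fin n → Point n
e i = tabulate (λ j → does (FinP._≟_ j i))

-- enumeration of all points of 𝔹^n (each exactly once)
allPoints : (n : ℕ) → List (Point n)
allPoints zero = [] ∷ []
allPoints (suc n) = List.map (false ∷_) (allPoints n) List.++ List.map (true ∷_) (allPoints n)

allIdx : (n : ℕ) → List (Fin n)
allIdx zero = []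
allIdx (suc n) = zero ∷ List.map suc (allIdx n)

card : ∀ {n} → SubsetB n → ℕ
card {n} X = length (filter (λ x → BoolP._≟_ (X x) true) (allPoints n))

-- N(X) = { x ⊕ e_i : x ∈ X, i ∈ V };  y ∈ N(X) iff y ⊕ e_i ∈ X for some i
Nbhd : ∀ {n} → SubsetB n → SubsetB n
Nbhd {n} X y = any (λ i → X (y ⊕ e i)) (allIdx n)

weight : ∀ {n} → Point n → ℕ
weight [] = 0
weight (true ∷ x) = suc (weight x)
weight (false ∷ x) = weight x

isEven : ℕ → Bool
isEven zero = true
isEven (suc k) = not (isEven k)

Evens : ∀ {n} → SubsetB n
Evens x = isEven (weight x)

Odds : ∀ {n} → SubsetB n
Odds x = not (isEven (weight x))

-- Toggling coordinate i is a bijection of 𝔹^V that maps X into N(X); as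
-- |X| ≥ |N(X)|, it maps X onto N(X). So X ∘ toggle i = N(X) does not depend on i,
-- which makes X invariant under toggling two coordinates. Such double toggles
-- connect any two points of equal parity, so X contains the parity class of any
-- x₀ ∈ X; the other class consists of neighbours of x₀'s class, hence lies in
-- N(X) and misses X.
module Submission where

open import Defs
open import Data.Nat using (ℕ; suc; _≥_)
open import Data.Bool using (Bool; true; false; _∧_)
open import Data.Product using (∃)
open import Data.Sum using (_⊎_)
open import Relation.Binary.PropositionalEquality using (_≡_)

open import Data.Nat using (_+_; _≤_)
open import Data.Nat.Properties using (+-comm; ≤-antisym)
open import Data.Bool using (not; _xor_)
open import Data.Bool.Properties as Bool
  using (not-involutive; not-injective; not-¬; ¬-not; xor-same; xor-inverseˡ; ∧-identityʳ; T-≡)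
open import Data.Fin using (Fin; zero; suc)
open import Data.Vec using ([]; _∷_; tabulate)
open import Data.List using ([]; _∷_; _++_; filter; length; map)
open import Data.List.Properties using (length-map; length-++; length-filter; filter-++; filter-reject; filter-complete)
open import Data.List.Membership.Propositional using (_∈_; lose)
open import Data.List.Membership.Propositional.Properties
  using (∈-map⁺; ∈-++⁺ˡ; ∈-++⁺ʳ; ∈-filter⁺; ∈-filter⁻)
open import Data.List.Relation.Unary.Any using (here; there)
open import Data.List.Relation.Unary.Any.Properties using (any⁺)
open import Data.Product using (_,_; proj₂)
open import Data.Sum using (inj₁; inj₂)
open import Function using (_∘_; id; Equivalence)
open import Relation.Nullary using (Dec; yes; no; does; contradiction)
open import Relation.Unary using (Pred; Decidable)
open import Relation.Binary.PropositionalEquality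
  using (refl; sym; trans; cong; cong₂; subst; module ≡-Reasoning)

≡true-⇔⇒≡ : ∀ {a b} → (a ≡ true → b ≡ true) → (b ≡ true → a ≡ true) → a ≡ b
≡true-⇔⇒≡ {true}          a⇒b _   = sym (a⇒b refl)
≡true-⇔⇒≡ {false} {true}  _   b⇒a = b⇒a refl
≡true-⇔⇒≡ {false} {false} _   _   = refl

toggle : ∀ {n} → Fin n → Point n → Point n
toggle zero    (b ∷ x) = not b ∷ x
toggle (suc i) (b ∷ x) = b ∷ toggle i x

⊕-identityʳ : ∀ {n} (x : Point n) → x ⊕ tabulate (λ _ → false) ≡ x
⊕-identityʳ []      = refl
⊕-identityʳ (b ∷ x) = cong₂ _∷_ (Bool.xor-identityʳ b) (⊕-identityʳ x)

⊕-e≡toggle : ∀ {n} (x : Point n) (i : Fin n) → x ⊕ e i ≡ toggle i x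
⊕-e≡toggle (b ∷ x) zero    = cong₂ _∷_ (Bool.xor-comm b true) (⊕-identityʳ x)
⊕-e≡toggle (b ∷ x) (suc i) = cong₂ _∷_ (Bool.xor-identityʳ b) (⊕-e≡toggle x i)

toggle-involutive : ∀ {n} (i : Fin n) (x : Point n) → toggle i (toggle i x) ≡ x
toggle-involutive zero    (b ∷ x) = cong (_∷ x) (not-involutive b)
toggle-involutive (suc i) (b ∷ x) = cong (b ∷_) (toggle-involutive i x)

Evens-toggle : ∀ {n} (i : Fin n) (x : Point n) → Evens (toggle i x) ≡ not (Evens x)
Evens-toggle zero    (true  ∷ x) = sym (not-involutive _)
Evens-toggle zero    (false ∷ x) = refl
Evens-toggle (suc i) (true  ∷ x) = cong not (Evens-toggle i x)
Evens-toggle (suc i) (false ∷ x) = Evens-toggle i x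

Evens-∷-cancel : ∀ {n} a {x y : Point n} → Evens (a ∷ x) ≡ Evens (a ∷ y) → Evens x ≡ Evens y
Evens-∷-cancel true  = not-injective
Evens-∷-cancel false = id

ConstantOnUnitSpheres : ∀ {n} → (Point n → Bool) → Set
ConstantOnUnitSpheres f = ∀ i j y → f (toggle i y) ≡ f (toggle j y)

ConstantOnUnitSpheres-∷ : ∀ {n} (f : Point (suc n) → Bool) a →
                          ConstantOnUnitSpheres f → ConstantOnUnitSpheres (f ∘ (a ∷_))
ConstantOnUnitSpheres-∷ f a const i j y = const (suc i) (suc j) (a ∷ y)

ConstantOnUnitSpheres-toggle₀₁ : ∀ {n} (f : Point (suc (suc n)) → Bool) → ConstantOnUnitSpheres f →
                                 ∀ a c x → f (a ∷ c ∷ x) ≡ f (not a ∷ not c ∷ x)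
ConstantOnUnitSpheres-toggle₀₁ f const a c x = begin
  f (a ∷ c ∷ x)                       ≡⟨ cong (λ c′ → f (a ∷ c′ ∷ x)) (sym (not-involutive c)) ⟩
  f (toggle (suc zero) (a ∷ not c ∷ x)) ≡⟨ const (suc zero) zero (a ∷ not c ∷ x) ⟩
  f (not a ∷ not c ∷ x)               ∎
  where open ≡-Reasoning

-- Points of equal parity are joined by a chain of double toggles, each of which
-- moves between two points of a common unit sphere.
constant-on-parity-classes : ∀ {n} (f : Point n → Bool) → ConstantOnUnitSpheres f →
                             ∀ {x y} → Evens x ≡ Evens y → f x ≡ f y
constant-on-parity-classes f const {[]} {[]} p = refl
constant-on-parity-classes f const {a ∷ x} {b ∷ y} p with a Bool.≟ b
... | yes refl = constant-on-parity-classes (f ∘ (a ∷_)) (ConstantOnUnitSpheres-∷ f a const) (Evens-∷-cancel a p)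
... | no a≢b with refl ← ¬-not (a≢b ∘ sym) with x | y
...   | [] | [] = contradiction (trans p (Evens-toggle zero (a ∷ []))) (not-¬ refl)
...   | c ∷ x′ | y = trans (ConstantOnUnitSpheres-toggle₀₁ f const a c x′)
                       (constant-on-parity-classes (f ∘ (not a ∷_)) (ConstantOnUnitSpheres-∷ f (not a) const)
                                                   (Evens-∷-cancel (not a) (trans double-toggle p)))
  where
  double-toggle : Evens (not a ∷ not c ∷ x′) ≡ Evens (a ∷ c ∷ x′)
  double-toggle = begin
    Evens (toggle zero (toggle (suc zero) (a ∷ c ∷ x′))) ≡⟨ Evens-toggle zero (a ∷ not c ∷ x′) ⟩
    not (Evens (toggle (suc zero) (a ∷ c ∷ x′)))        ≡⟨ cong not (Evens-toggle (suc zero) (a ∷ c ∷ x′)) ⟩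
    not (not (Evens (a ∷ c ∷ x′)))                      ≡⟨ not-involutive _ ⟩
    Evens (a ∷ c ∷ x′)                                  ∎
    where open ≡-Reasoning

parity-class-indicator : ∀ {n} (f : Point n → Bool) → (∀ {x y} → Evens x ≡ Evens y → f x ≡ f y) →
                         ∀ x₀ i → f x₀ ≡ true → f (toggle i x₀) ≡ false →
                         (∀ x → f x ≡ Evens x) ⊎ (∀ x → f x ≡ Odds x)
parity-class-indicator f const x₀ i fx₀ fx₁ = by-parity-of-x₀ (Evens x₀) indicator
  where
  open ≡-Reasoning

  by-parity-of-x₀ : ∀ p → (∀ x → f x ≡ not p xor Evens x) → (∀ x → f x ≡ Evens x) ⊎ (∀ x → f x ≡ Odds x)
  by-parity-of-x₀ true  = inj₁
  by-parity-of-x₀ false = inj₂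

  indicator : ∀ x → f x ≡ not (Evens x₀) xor Evens x
  indicator x with Evens x Bool.≟ Evens x₀
  ... | yes same = begin
    f x                         ≡⟨ const same ⟩
    f x₀                        ≡⟨ fx₀ ⟩
    true                        ≡⟨ xor-inverseˡ (Evens x₀) ⟨
    not (Evens x₀) xor Evens x₀ ≡⟨ cong (not (Evens x₀) xor_) same ⟨
    not (Evens x₀) xor Evens x  ∎
  ... | no differ = begin
    f x                               ≡⟨ const (trans (¬-not differ) (sym (Evens-toggle i x₀))) ⟩
    f (toggle i x₀)                   ≡⟨ fx₁ ⟩
    false                             ≡⟨ xor-same (not (Evens x₀)) ⟨
    not (Evens x₀) xor not (Evens x₀) ≡⟨ cong (not (Evens x₀) xor_) (¬-not differ) ⟨
    not (Evens x₀) xor Evens x        ∎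

filter-map : ∀ {a b p} {A : Set a} {B : Set b} {P : Pred B p} (P? : Decidable P) (f : A → B) xs →
             filter P? (map f xs) ≡ map f (filter (P? ∘ f) xs)
filter-map P? f []       = refl
filter-map P? f (x ∷ xs) with does (P? (f x))
... | true  = cong (f x ∷_) (filter-map P? f xs)
... | false = filter-map P? f xs

module _ {a p q} {A : Set a} {P : Pred A p} {Q : Pred A q}
         (P? : Decidable P) (Q? : Decidable Q) (P⊆Q : ∀ {x} → P x → Q x) where

  filter-filter-⊆ : ∀ xs → filter P? (filter Q? xs) ≡ filter P? xs
  filter-filter-⊆ []       = refl
  filter-filter-⊆ (x ∷ xs) with Q? x
  ... | no ¬Qx = trans (filter-filter-⊆ xs) (sym (filter-reject P? (¬Qx ∘ P⊆Q)))
  ... | yes _ with does (P? x)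
  ...   | true  = cong (x ∷_) (filter-filter-⊆ xs)
  ...   | false = filter-filter-⊆ xs

  length-filter-≤⇒⊇ : ∀ xs → length (filter Q? xs) ≤ length (filter P? xs) →
                      ∀ {x} → x ∈ xs → Q x → P x
  length-filter-≤⇒⊇ xs |Q|≤|P| x∈xs Qx =
    proj₂ (∈-filter⁻ P? {xs = filter Q? xs} (subst (_ ∈_) (sym fixed) (∈-filter⁺ Q? x∈xs Qx)))
    where
    fixed : filter P? (filter Q? xs) ≡ filter Q? xs
    fixed = filter-complete P? (≤-antisym (length-filter P? (filter Q? xs))
      (subst (length (filter Q? xs) ≤_) (sym (cong length (filter-filter-⊆ xs))) |Q|≤|P|))

_∈?_ : ∀ {n} (x : Point n) (X : SubsetB n) → Dec (X x ≡ true)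
x ∈? X = X x Bool.≟ true

card-∷ : ∀ {n} (X : SubsetB (suc n)) → card X ≡ card (X ∘ (false ∷_)) + card (X ∘ (true ∷_))
card-∷ {n} X = begin
  length (filter (_∈? X) (map (false ∷_) (allPoints n) ++ map (true ∷_) (allPoints n)))
    ≡⟨ cong length (filter-++ (_∈? X) (map (false ∷_) (allPoints n)) _) ⟩
  length (filter (_∈? X) (map (false ∷_) (allPoints n)) ++ filter (_∈? X) (map (true ∷_) (allPoints n)))
    ≡⟨ length-++ (filter (_∈? X) (map (false ∷_) (allPoints n))) ⟩
  length (filter (_∈? X) (map (false ∷_) (allPoints n))) + length (filter (_∈? X) (map (true ∷_) (allPoints n)))
    ≡⟨ cong₂ _+_ (restrict false) (restrict true) ⟩
  card (X ∘ (false ∷_)) + card (X ∘ (true ∷_)) ∎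
  where
  open ≡-Reasoning
  restrict : ∀ b → length (filter (_∈? X) (map (b ∷_) (allPoints n))) ≡ card (X ∘ (b ∷_))
  restrict b = trans (cong length (filter-map (_∈? X) (b ∷_) (allPoints n))) (length-map (b ∷_) (filter (_∈? (X ∘ (b ∷_))) (allPoints n)))

card-toggle : ∀ {n} (i : Fin n) (X : SubsetB n) → card (X ∘ toggle i) ≡ card X
card-toggle zero X = begin
  card (X ∘ toggle zero)                      ≡⟨ card-∷ (X ∘ toggle zero) ⟩
  card (X ∘ (true ∷_)) + card (X ∘ (false ∷_)) ≡⟨ +-comm (card (X ∘ (true ∷_))) _ ⟩
  card (X ∘ (false ∷_)) + card (X ∘ (true ∷_)) ≡⟨ sym (card-∷ X) ⟩
  card X                                      ∎
  where open ≡-Reasoning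
card-toggle (suc i) X = begin
  card (X ∘ toggle (suc i))                                       ≡⟨ card-∷ (X ∘ toggle (suc i)) ⟩
  card (X ∘ (false ∷_) ∘ toggle i) + card (X ∘ (true ∷_) ∘ toggle i) ≡⟨ cong₂ _+_ (card-toggle i _) (card-toggle i _) ⟩
  card (X ∘ (false ∷_)) + card (X ∘ (true ∷_))                    ≡⟨ sym (card-∷ X) ⟩
  card X                                                          ∎
  where open ≡-Reasoning

∈-allPoints : ∀ {n} (x : Point n) → x ∈ allPoints n
∈-allPoints []          = here refl
∈-allPoints (false ∷ x) = ∈-++⁺ˡ (∈-map⁺ (false ∷_) (∈-allPoints x))
∈-allPoints (true ∷ x)  = ∈-++⁺ʳ (map (false ∷_) (allPoints _)) (∈-map⁺ (true ∷_) (∈-allPoints x))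

∈-allIdx : ∀ {n} (i : Fin n) → i ∈ allIdx n
∈-allIdx zero    = here refl
∈-allIdx (suc i) = there (∈-map⁺ suc (∈-allIdx i))

toggle∈Nbhd : ∀ {n} (X : SubsetB n) i y → X (toggle i y) ≡ true → Nbhd X y ≡ true
toggle∈Nbhd X i y toggle∈X = Equivalence.to T-≡ (any⁺ (λ j → X (y ⊕ e j))
  (lose (∈-allIdx i) (Equivalence.from T-≡ (subst (λ z → X z ≡ true) (sym (⊕-e≡toggle y i)) toggle∈X))))

Nbhd⊆toggle : ∀ {n} (X : SubsetB n) → card (Nbhd X) ≤ card X →
              ∀ i y → Nbhd X y ≡ true → X (toggle i y) ≡ true
Nbhd⊆toggle {n} X |N|≤|X| i y =
  length-filter-≤⇒⊇ (_∈? (X ∘ toggle i)) (_∈? Nbhd X) (toggle∈Nbhd X i _) (allPoints n)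
    (subst (card (Nbhd X) ≤_) (sym (card-toggle i X)) |N|≤|X|) (∈-allPoints y)

lemma1 : (n : ℕ) → (X : SubsetB (suc n)) →
           ∃ (λ x → X x ≡ true) →
           (∀ x → (X x ∧ Nbhd X x) ≡ false) →
           card X ≥ card (Nbhd X) →
           (∀ x → X x ≡ Evens x) ⊎ (∀ x → X x ≡ Odds x)
lemma1 n X (x₀ , x₀∈X) disjoint |N|≤|X| =
  parity-class-indicator X (constant-on-parity-classes X toggles-agree) x₀ zero x₀∈X x₁∉X
  where
  toggle≡Nbhd : ∀ i y → X (toggle i y) ≡ Nbhd X y
  toggle≡Nbhd i y = ≡true-⇔⇒≡ (toggle∈Nbhd X i y) (Nbhd⊆toggle X |N|≤|X| i y)

  toggles-agree : ConstantOnUnitSpheres X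
  toggles-agree i j y = trans (toggle≡Nbhd i y) (sym (toggle≡Nbhd j y))

  x₁∈N : Nbhd X (toggle zero x₀) ≡ true
  x₁∈N = toggle∈Nbhd X zero _ (subst (λ z → X z ≡ true) (sym (toggle-involutive zero x₀)) x₀∈X)

  x₁∉X : X (toggle zero x₀) ≡ false
  x₁∉X = trans (sym (∧-identityʳ _)) (subst (λ b → (X (toggle zero x₀) ∧ b) ≡ false) x₁∈N (disjoint _))
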